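{- Let $G$ be a tolerance graph and let $u$ be an unbounded vertex of $G$ in a projection representation $R$ of $G$. Then for every $v\in N(u)$: $r(u)<_R r(v)$, $L(v)<_R L(u)$, and $v$ is a bounded vertex in $R$.
   Context: Projection representation: fix parallel horizontal lines $L_1$ (upper), $L_2$ (lower). It assigns to each vertex $u$ either (bounded) a parallelogram $P_u$ with upper side $[L(u),R(u)]$ on $L_1$, lower side $[l(u),r(u)]$ on $L_2$, the other two sides parallel, or (unbounded) a segment $P_u$ from $l(u)=r(u)$ on $L_2$ to $L(u)=R(u)$ on $L_1$; $\phi_u\in(0,\pi)$ is the angle of the non-horizontal sides of $P_u$ with the positive direction of $L_2$. Induced adjacency: two bounded vertices adjacent iff $P_u\cap P_v\neq\emptyset$; bounded $v$ and unbounded $u$ adjacent iff $P_u\cap P_v\neq\emptyset$ and $\phi_v>\phi_u$; two unbounded vertices never adjacent. $R$ is a projection representation of $G$ if its induced graph is $G$; all endpoints and slopes are distinct. Tolerance graphs are exactly the graphs having a projection representation. For points $a,b$ on the same line $L_i$, $a<_R b$ means $a$ lies to the left of $b$. -}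

module Defs where

open import Level using (0ℓ)
open import Data.Bool using (Bool; true; false)
open import Data.Fin using (Fin)
open import Data.Product using (Σ; ∃; _×_; _,_)
open import Data.Sum using (_⊎_)
open import Data.Empty using (⊥)
open import Relation.Nullary using (¬_)
open import Relation.Binary using (Rel; IsStrictTotalOrder)
open import Relation.Binary.PropositionalEquality using (_≡_; _≢_)
open import Algebra.Structures using (IsCommutativeRing)
open import Function.Bundles using (_⇔_)

-- A linearly ordered field (the real line ℝ is an instance); coordinates
-- of points on L₁, L₂ live in its carrier.
record OrderedField : Set₁ where
  infixl 6 _+_
  infixl 7 _*_
  infix 4 _<_ _≤_
  infixl 6 _-_
  field
    Carrier : Set
    _+_ _*_ : Carrier → Carrier → Carrier
    -_ : Carrier → Carrier
    0# 1# : Carrier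
    isCommutativeRing : IsCommutativeRing _≡_ _+_ _*_ -_ 0# 1#
    _<_ : Rel Carrier 0ℓ
    isStrictTotalOrder : IsStrictTotalOrder _≡_ _<_
    +-mono-< : ∀ {a b} c → a < b → a + c < b + c
    *-pos : ∀ {a b} → 0# < a → 0# < b → 0# < a * b
    inverse : ∀ a → a ≢ 0# → Σ Carrier (λ b → a * b ≡ 1#)
    0≢1 : 0# ≢ 1#

  _-_ : Carrier → Carrier → Carrier
  a - b = a + (- b)

  _≤_ : Carrier → Carrier → Set
  a ≤ b = a < b ⊎ a ≡ b

module _ (F : OrderedField) where
  open OrderedField F

  -- Convention: L₂ is the line y = 0, L₁ is the line y = 1 (an affine
  -- change of coordinates).  A point of L₂ / L₁ is given by its x-coordinate.
  record Vertex : Set where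
    field
      bounded : Bool
      l r L R : Carrier   -- l(u), r(u) on L₂ ; L(u), R(u) on L₁

  open Vertex public

  -- Horizontal displacement of the non-horizontal sides (from L₂ up to L₁).
  -- This is cot φ_u (the height is 1), so  φ_v > φ_u  ⇔  run v < run u.
  run : Vertex → Carrier
  run u = L u - l u

  WellShaped : Vertex → Set
  WellShaped u with bounded u
  ... | true  = (l u < r u) × (L u < R u) × (R u - r u ≡ L u - l u)
  ... | false = (l u ≡ r u) × (L u ≡ R u)

  InP : Vertex → Carrier → Carrier → Set
  InP u x y = (0# ≤ y) × (y ≤ 1#) × (l u + y * run u ≤ x) × (x ≤ r u + y * run u)

  Meet : Vertex → Vertex → Set
  Meet u v = ∃ λ x → ∃ λ y → InP u x y × InP v x y

  AngleLess : Vertex → Vertex → Set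
  AngleLess u v = run v < run u

  InducedAdj : Vertex → Vertex → Set
  InducedAdj u v with bounded u | bounded v
  ... | true  | true  = Meet u v
  ... | true  | false = Meet u v × AngleLess v u
  ... | false | true  = Meet u v × AngleLess u v
  ... | false | false = ⊥

  Valid : ∀ {n} → (Fin n → Vertex) → Set
  Valid {n} ρ = (∀ u → WellShaped (ρ u))
    × (∀ u v → u ≢ v →
         (l (ρ u) ≢ l (ρ v)) × (l (ρ u) ≢ r (ρ v)) × (r (ρ u) ≢ r (ρ v))
       × (L (ρ u) ≢ L (ρ v)) × (L (ρ u) ≢ R (ρ v)) × (R (ρ u) ≢ R (ρ v))
       × (run (ρ u) ≢ run (ρ v)))

  IsProjectionRepresentation : ∀ {n} → (Fin n → Fin n → Set) → (Fin n → Vertex) → Set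
  IsProjectionRepresentation {n} G ρ =
    Valid ρ × (∀ u v → G u v ⇔ ((u ≢ v) × InducedAdj (ρ u) (ρ v)))

-- Let u be unbounded.  Then P_u is the segment from (a , 0) to (a + s , 1)
-- on L₂ resp. L₁, where a = l(u) = r(u) and s = run(u) = L(u) - l(u).  A
-- neighbour v of u is bounded (two unbounded vertices are never adjacent),
-- P_v meets P_u in a point (x , y) with x = a + y·s, and φ_v > φ_u, i.e.
-- run(v) < s: the sides of P_v are steeper than the line ℓ carrying P_u.
-- Both inequalities then follow from two facts about an arbitrary P_v whose
-- sides are not flatter than a line ℓ: if P_v has a point on or to the right
-- of ℓ, its lower right corner r(v) is on or to the right of ℓ ∩ L₂; if it
-- has a point on or to the left of ℓ, its upper left corner L(v) is on or to
-- the left of ℓ ∩ L₁.  Distinctness of endpoints makes both strict.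
module Submission where

open import Defs
open import Data.Nat using (ℕ)
open import Data.Fin using (Fin)
open import Data.Bool using (true; false)
open import Data.Product using (_×_; _,_)
open import Data.Sum using (inj₁; inj₂)
open import Data.Empty using (⊥-elim)
open import Relation.Binary.PropositionalEquality
  using (_≡_; _≢_; refl; sym; trans; cong)
open import Relation.Binary.Structures using (IsStrictTotalOrder)
open import Relation.Binary.Bundles using (StrictPartialOrder)
open import Algebra.Bundles using (CommutativeRing)
import Algebra.Properties.Group as GroupProperties
import Relation.Binary.Reasoning.StrictPartialOrder as StrictReasoning
open import Function.Bundles using (Equivalence)

module OrderedFieldFacts (F : OrderedField) where
  open OrderedField F
  open IsStrictTotalOrder isStrictTotalOrder using (isStrictPartialOrder)

  ring : CommutativeRing _ _
  ring = record { isCommutativeRing = isCommutativeRing }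

  open CommutativeRing ring
    using (+-comm; +-assoc; +-identityˡ; -‿inverseʳ; distribˡ; distribʳ; zeroˡ; *-identityˡ; +-group)
  open GroupProperties +-group using (//-rightDividesˡ; //-rightDividesʳ)

  strictPartialOrder : StrictPartialOrder _ _ _
  strictPartialOrder = record { isStrictPartialOrder = isStrictPartialOrder }

  open StrictReasoning strictPartialOrder public

  ≤∧≢⇒< : ∀ {a b} → a ≤ b → a ≢ b → a < b
  ≤∧≢⇒< (inj₁ a<b) _   = a<b
  ≤∧≢⇒< (inj₂ a≡b) a≢b = ⊥-elim (a≢b a≡b)

  +-monoˡ-≤ : ∀ {a b} c → a ≤ b → a + c ≤ b + c
  +-monoˡ-≤ c (inj₁ a<b)  = inj₁ (+-mono-< c a<b)
  +-monoˡ-≤ c (inj₂ refl) = inj₂ refl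

  +-monoʳ-≤ : ∀ c {a b} → a ≤ b → c + a ≤ c + b
  +-monoʳ-≤ c {a} {b} a≤b = begin
    c + a ≡⟨ +-comm c a ⟩
    a + c ≤⟨ +-monoˡ-≤ c a≤b ⟩
    b + c ≡⟨ +-comm b c ⟩
    c + b ∎

  +-cancelʳ-≤ : ∀ {a b} c → a + c ≤ b + c → a ≤ b
  +-cancelʳ-≤ {a} {b} c a+c≤b+c = begin
    a             ≡⟨ sym (//-rightDividesʳ c a) ⟩
    a + c - c     ≤⟨ +-monoˡ-≤ (- c) a+c≤b+c ⟩
    b + c - c     ≡⟨ //-rightDividesʳ c b ⟩
    b             ∎

  *-monoˡ-≤ : ∀ {y a b} → 0# ≤ y → a ≤ b → y * a ≤ y * b
  *-monoˡ-≤ _ (inj₂ refl) = inj₂ refl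
  *-monoˡ-≤ {a = a} {b} (inj₂ refl) (inj₁ _) = inj₂ (trans (zeroˡ a) (sym (zeroˡ b)))
  *-monoˡ-≤ {y} {a} {b} (inj₁ 0<y) (inj₁ a<b) = inj₁ (begin-strict
    y * a               ≡⟨ sym (+-identityˡ (y * a)) ⟩
    0# + y * a          <⟨ +-mono-< (y * a) (*-pos 0<y 0<b-a) ⟩
    y * (b - a) + y * a ≡⟨ sym (distribˡ y (b - a) a) ⟩
    y * (b - a + a)     ≡⟨ cong (y *_) (//-rightDividesˡ a b) ⟩
    y * b               ∎)
    where
    0<b-a : 0# < b - a
    0<b-a = begin-strict
      0#    ≡⟨ sym (-‿inverseʳ a) ⟩
      a - a <⟨ +-mono-< (- a) a<b ⟩
      b - a ∎

  0≤1-y : ∀ {y} → y ≤ 1# → 0# ≤ 1# - y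
  0≤1-y {y} y≤1 = begin
    0#     ≡⟨ sym (-‿inverseʳ y) ⟩
    y - y  ≤⟨ +-monoˡ-≤ (- y) y≤1 ⟩
    1# - y ∎

  split : ∀ p y t → p + y * t + (1# - y) * t ≡ p + t
  split p y t = begin-equality
    p + y * t + (1# - y) * t   ≡⟨ +-assoc p (y * t) ((1# - y) * t) ⟩
    p + (y * t + (1# - y) * t) ≡⟨ cong (p +_) (sym (distribʳ t y (1# - y))) ⟩
    p + (y + (1# - y)) * t     ≡⟨ cong (λ z → p + z * t) y+[1-y]≡1 ⟩
    p + 1# * t                 ≡⟨ cong (p +_) (*-identityˡ t) ⟩
    p + t                      ∎
    where
    y+[1-y]≡1 : y + (1# - y) ≡ 1#
    y+[1-y]≡1 = begin-equality
      y + (1# - y) ≡⟨ +-comm y (1# - y) ⟩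
      1# - y + y   ≡⟨ //-rightDividesˡ y 1# ⟩
      1#           ∎

  +-diff : ∀ a b → a + (b - a) ≡ b
  +-diff a b = trans (+-comm a (b - a)) (//-rightDividesˡ a b)

-- The corners of a parallelogram P_v relative to a line ℓ that meets L₂ at a
-- and L₁ at a + s and is at most as steep as the sides of P_v (run v ≤ s).
module Corners (F : OrderedField) where
  open OrderedField F
  open OrderedFieldFacts F

  upper-left : ∀ v → l v + run F v ≡ L v
  upper-left v = +-diff (l v) (L v)

  lower-right-corner : ∀ v {x y a s} → InP F v x y → a + y * s ≤ x → run F v ≤ s →
                       a ≤ r v
  lower-right-corner v {x} {y} {a} {s} (0≤y , _ , _ , x≤right) ℓ≤x run≤s =
    +-cancelʳ-≤ (y * run F v) (begin
      a + y * run F v   ≤⟨ +-monoʳ-≤ a (*-monoˡ-≤ 0≤y run≤s) ⟩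
      a + y * s         ≤⟨ ℓ≤x ⟩
      x                 ≤⟨ x≤right ⟩
      r v + y * run F v ∎)

  -- A point of P_v on or to the left of ℓ forces L(v) on or to the left of a + s:
  -- walk up from the point along a side of P_v resp. along ℓ.
  upper-left-corner : ∀ v {x y a s} → InP F v x y → x ≤ a + y * s → run F v ≤ s →
                      L v ≤ a + s
  upper-left-corner v {x} {y} {a} {s} (_ , y≤1 , left≤x , _) x≤ℓ run≤s = begin
    L v                                      ≡⟨ sym (upper-left v) ⟩
    l v + run F v                            ≡⟨ sym (split (l v) y (run F v)) ⟩
    l v + y * run F v + (1# - y) * run F v   ≤⟨ +-monoʳ-≤ _ (*-monoˡ-≤ (0≤1-y y≤1) run≤s) ⟩
    l v + y * run F v + (1# - y) * s         ≤⟨ +-monoˡ-≤ _ left≤x ⟩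
    x + (1# - y) * s                         ≤⟨ +-monoˡ-≤ _ x≤ℓ ⟩
    a + y * s + (1# - y) * s                 ≡⟨ split a y s ⟩
    a + s                                    ∎

module UnboundedVertex (F : OrderedField) where
  open OrderedField F
  open OrderedFieldFacts F
  open Corners F

  segment : ∀ u → bounded u ≡ false → WellShaped F u → l u ≡ r u
  segment u unb shape with bounded u
  segment u refl (l≡r , _) | false = l≡r

  unbounded-adjacency : ∀ u v → bounded u ≡ false → InducedAdj F u v →
                        Meet F u v × AngleLess F u v × bounded v ≡ true
  unbounded-adjacency u v unb adj with bounded u | bounded v
  unbounded-adjacency u v refl (meet , angle) | false | true = meet , angle , refl
  unbounded-adjacency u v refl ()             | false | false

  -- For a neighbour v of an unbounded vertex u: r(u) ≤ r(v), L(v) ≤ L(u), and v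
  -- is bounded.  The common point lies on P_u, i.e. on the line ℓ carrying P_u.
  neighbour-corners : ∀ u v → bounded u ≡ false → WellShaped F u → InducedAdj F u v →
                      r u ≤ r v × L v ≤ L u × bounded v ≡ true
  neighbour-corners u v unb shape adj
    with unbounded-adjacency u v unb adj | segment u unb shape
  ... | (_ , _ , (_ , _ , left≤x , x≤right) , inPv) , angle , bounded-v | refl =
    lower-right-corner v inPv left≤x (inj₁ angle) ,
    (begin
      L v           ≤⟨ upper-left-corner v inPv x≤right (inj₁ angle) ⟩
      l u + run F u ≡⟨ upper-left u ⟩
      L u           ∎) ,
    bounded-v

lemma1 : (F : OrderedField) → let open OrderedField F in
         {n : ℕ} (G : Fin n → Fin n → Set) (ρ : Fin n → Vertex F) →
         IsProjectionRepresentation F G ρ →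
         (u : Fin n) → bounded (ρ u) ≡ false →
         (v : Fin n) → G u v →
         (r (ρ u) < r (ρ v)) × (L (ρ v) < L (ρ u)) × (bounded (ρ v) ≡ true)
lemma1 F G ρ ((shape , distinct) , adjacency) u unb v uv
  with Equivalence.to (adjacency u v) uv
... | u≢v , adj
  with UnboundedVertex.neighbour-corners F (ρ u) (ρ v) unb (shape u) adj
     | distinct u v u≢v
... | r≤r , L≤L , bounded-v | _ , _ , r≢r , L≢L , _ =
  ≤∧≢⇒< r≤r r≢r , ≤∧≢⇒< L≤L (λ L≡L → L≢L (sym L≡L)) , bounded-v
  where open OrderedFieldFacts F using (≤∧≢⇒<)
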